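{- Let $n = p_1^{\alpha_1}p_2^{\alpha_2}\cdots p_t^{\alpha_t}$, where $p_1 < \cdots < p_t$ are primes and $\alpha_i\ge 1$. Then $$\mathrm{IR}(X_n) \leq \left(1 + 2\cdot\frac{p_1}{p_t}\cdot\frac{1}{p_1^{\alpha_1-1}p_2^{\alpha_2-1}\cdots p_t^{\alpha_t-1}}\right)\alpha(X_n).$$
   Context: $X_n$ is the graph on $\{0,\dots,n-1\}$ with $a,b$ adjacent iff $\gcd(a-b,n)=1$. $\alpha(G)$ is the maximum size of an independent set. A set $S$ of vertices is irredundant if every $v\in S$ has a private neighbor, i.e. a vertex in the closed neighborhood of $v$ not in the closed neighborhood of any vertex of $S\setminus\{v\}$; $\mathrm{IR}(G)$ is the maximum size of an irredundant set. -}

module Defs where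

open import Data.Nat using (ℕ; zero; suc; _+_; _*_; _∸_; _^_; _≤_; _<_; ∣_-_∣)
open import Data.Nat.GCD using (gcd)
open import Data.Nat.Primality using (Prime)
open import Data.Fin using (Fin; toℕ; fromℕ) renaming (zero to fzero; suc to fsuc; _<_ to _<ᶠ_)
open import Data.Fin.Subset using (Subset; _∈_; _∉_; ∣_∣)
open import Data.Product using (Σ; _×_)
open import Data.Sum using (_⊎_)
open import Relation.Nullary using (¬_)
open import Relation.Binary.PropositionalEquality using (_≡_; _≢_)

-- Adjacency in the unitary Cayley graph X_n on vertex set {0,...,n-1} (= Fin n):
-- a ~ b iff a ≠ b and gcd(|a - b|, n) = 1.
Adj : (n : ℕ) → Fin n → Fin n → Set
Adj n a b = (a ≢ b) × (gcd ∣ toℕ a - toℕ b ∣ n ≡ 1)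

InClosedNbhd : (n : ℕ) → Fin n → Fin n → Set
InClosedNbhd n v w = (w ≡ v) ⊎ Adj n v w

Independent : (n : ℕ) → Subset n → Set
Independent n S = ∀ a b → a ∈ S → b ∈ S → ¬ Adj n a b

IsIndependenceNumber : (n : ℕ) → ℕ → Set
IsIndependenceNumber n k =
  (Σ (Subset n) λ S → Independent n S × ∣ S ∣ ≡ k) ×
  (∀ S → Independent n S → ∣ S ∣ ≤ k)

PrivateNbr : (n : ℕ) → Subset n → Fin n → Fin n → Set
PrivateNbr n S v w = InClosedNbhd n v w × (∀ u → u ∈ S → u ≢ v → ¬ InClosedNbhd n u w)

Irredundant : (n : ℕ) → Subset n → Set
Irredundant n S = ∀ v → v ∈ S → Σ (Fin n) λ w → PrivateNbr n S v w

IsIRNumber : (n : ℕ) → ℕ → Set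
IsIRNumber n k =
  (Σ (Subset n) λ S → Irredundant n S × ∣ S ∣ ≡ k) ×
  (∀ S → Irredundant n S → ∣ S ∣ ≤ k)

prodFin : (t : ℕ) → (Fin t → ℕ) → ℕ
prodFin zero f = 1
prodFin (suc t) f = f fzero * prodFin t (λ i → f (fsuc i))

-- A prime factorisation n = p_1^{a_1} ⋯ p_t^{a_t} with t = s+1 ≥ 1,
-- p_1 < ⋯ < p_t primes and a_i ≥ 1.
IsFactorisation : (n s : ℕ) → (Fin (suc s) → ℕ) → (Fin (suc s) → ℕ) → Set
IsFactorisation n s p a =
  (∀ i → Prime (p i)) ×
  (∀ i j → i <ᶠ j → p i < p j) ×
  (∀ i → 1 ≤ a i) ×
  (n ≡ prodFin (suc s) (λ i → p i ^ a i))

module Submission where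

-- Write R = p_1 ⋯ p_{t-1}, q = p_t and P = ∏ p_i^{a_i-1}, so n = R q P.
-- Vertices x, y are adjacent iff x ≠ y and no p_i divides x - y.
--  * Lower bound on α: for a divisor d ≥ 2 of n the multiples of d are
--    independent, so n ≤ d α; we use d = p_1.
--  * Upper bound on IR: split an irredundant set S into the vertices that
--    are their own private neighbour (an independent set, so at most α of
--    them) and the others.  Among the latter, no three distinct vertices are
--    congruent modulo R (the fibre lemma below), so there are at most 2R.
--  * Hence IR ≤ α + 2R, and multiplying by qP gives
--    IR q P ≤ α q P + 2n ≤ α q P + 2 p_1 α.

open import Defs
open import Data.Nat using (ℕ; zero; suc; _+_; _*_; _∸_; _^_; _≤_; _<_; ∣_-_∣; NonZero; z≤n; s≤s; _<?_; _%_; >-nonZero; nonTrivial⇒n>1) renaming (_≟_ to _≟ℕ_)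
open import Data.Nat.Properties hiding (_≟_; suc-injective)
open import Data.Nat.Divisibility using (_∣_; _∣?_; divides; ∣-refl; ∣-trans; _∣0; ∣1⇒≡1; 0∣⇒≡0; m∣m*n; n∣m*n; ∣m∣n⇒∣m+n; ∣m+n∣m⇒∣n)
open import Data.Nat.DivMod using (_/_; m≡m%n+[m/n]*n; %-remove-+ʳ; m%n<n)
open import Data.Nat.GCD using (gcd; gcd-greatest)
open import Data.Nat.Coprimality using (Coprime; coprime⇒gcd≡1; coprime-divisor)
open import Data.Nat.Primality using (Prime; prime⇒irreducible; prime⇒nonTrivial; ¬prime[1])
open import Data.Nat.Solver using (module +-*-Solver)
open import Data.Bool using (Bool; true; false; if_then_else_)
open import Data.Fin using (Fin; toℕ; fromℕ; inject₁; _≟_) renaming (zero to fzero; suc to fsuc)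
open import Data.Fin.Properties using (suc-injective; ¬∀⟶∃¬)
open import Data.Fin.Subset using (Subset; _∈_; ∣_∣; _∪_; Empty; inside; outside)
open import Data.Fin.Subset.Properties using (_∈?_; p⊆q⇒∣p∣≤∣q∣; x∈p∪q⁺; Empty-unique; ∣⊥∣≡0)
open import Data.Vec using ([]; _∷_; tabulate; here; there)
open import Data.Vec.Properties using (lookup∘tabulate; []=⇒lookup; lookup⇒[]=)
open import Data.Sum using (_⊎_; inj₁; inj₂)
open import Data.Product using (_,_; Σ; proj₁; proj₂; _×_)
open import Data.Empty using (⊥; ⊥-elim)
open import Function using (mk⇔)
open import Relation.Nullary using (¬_; yes; no; does; ¬?)
open import Relation.Nullary.Decidable using (_×-dec_; dec-true; does-⇔)
open import Relation.Unary using (Decidable)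
open import Relation.Binary.PropositionalEquality

private variable n : ℕ

-- Congruence of natural numbers modulo d, phrased through the absolute
-- difference exactly as adjacency in X_n is.  (A record, so that x and y
-- can be inferred from a proof.)
record _≡_[mod_] (x y d : ℕ) : Set where
  constructor by-divisibility
  field divides-difference : d ∣ ∣ x - y ∣
open _≡_[mod_] public

≡mod-sym : ∀ {d x y} → x ≡ y [mod d ] → y ≡ x [mod d ]
≡mod-sym {d} {x} {y} (by-divisibility h) = by-divisibility (subst (d ∣_) (∣-∣-comm x y) h)

≡mod⇒%≡ : ∀ d .{{_ : NonZero d}} x y → x ≡ y [mod d ] → x % d ≡ y % d
≡mod⇒%≡ d x y (by-divisibility d∣diff) with ≤-total x y
... | inj₁ x≤y = sym (begin
      y % d             ≡⟨ cong (_% d) (sym (m+[n∸m]≡n x≤y)) ⟩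
      (x + (y ∸ x)) % d ≡⟨ %-remove-+ʳ x (subst (d ∣_) (m≤n⇒∣m-n∣≡n∸m x≤y) d∣diff) ⟩
      x % d             ∎)
  where open ≡-Reasoning
... | inj₂ y≤x = begin
      x % d             ≡⟨ cong (_% d) (sym (m+[n∸m]≡n y≤x)) ⟩
      (y + (x ∸ y)) % d ≡⟨ %-remove-+ʳ y (subst (d ∣_) (m≤n⇒∣n-m∣≡n∸m y≤x) d∣diff) ⟩
      y % d             ∎
  where open ≡-Reasoning

%≡⇒≡mod : ∀ d .{{_ : NonZero d}} x y → x % d ≡ y % d → x ≡ y [mod d ]
%≡⇒≡mod d x y eq = by-divisibility (subst (d ∣_) (sym difference) (divides ∣ x / d - y / d ∣ refl))
  where
  open ≡-Reasoning
  difference : ∣ x - y ∣ ≡ ∣ x / d - y / d ∣ * d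
  difference = begin
    ∣ x - y ∣                                  ≡⟨ cong₂ ∣_-_∣ (m≡m%n+[m/n]*n x d) (m≡m%n+[m/n]*n y d) ⟩
    ∣ x % d + x / d * d - y % d + y / d * d ∣  ≡⟨ cong (λ r → ∣ x % d + x / d * d - r + y / d * d ∣) (sym eq) ⟩
    ∣ x % d + x / d * d - x % d + y / d * d ∣  ≡⟨ ∣m+n-m+o∣≡∣n-o∣ (x % d) (x / d * d) (y / d * d) ⟩
    ∣ x / d * d - y / d * d ∣                  ≡⟨ sym (*-distribʳ-∣-∣ d (x / d) (y / d)) ⟩
    ∣ x / d - y / d ∣ * d                      ∎

≡mod-trans : ∀ {d x y z} → x ≡ y [mod d ] → y ≡ z [mod d ] → x ≡ z [mod d ]
≡mod-trans {zero} {x} {y} (by-divisibility 0∣diff) y≡z with ∣m-n∣≡0⇒m≡n {x} {y} (0∣⇒≡0 0∣diff)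
... | refl = y≡z
≡mod-trans {suc d} {x} {y} {z} x≡y y≡z =
  %≡⇒≡mod (suc d) x z (trans (≡mod⇒%≡ (suc d) x y x≡y) (≡mod⇒%≡ (suc d) y z y≡z))

≡mod-divisor : ∀ {d e x y} → d ∣ e → x ≡ y [mod e ] → x ≡ y [mod d ]
≡mod-divisor d∣e (by-divisibility e∣diff) = by-divisibility (∣-trans d∣e e∣diff)

≡mod-0 : ∀ {d x} → d ∣ x → x ≡ 0 [mod d ]
≡mod-0 {d} {x} d∣x = by-divisibility (subst (d ∣_) (sym (∣-∣-identityʳ x)) d∣x)

coprime-* : ∀ {m a b} → Coprime m a → Coprime m b → Coprime m (a * b)
coprime-* {m} {a} {b} m⊥a m⊥b (d∣m , d∣ab) = m⊥b (d∣m , coprime-divisor d⊥a d∣ab)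
  where
  d⊥a : Coprime _ a
  d⊥a (e∣d , e∣a) = m⊥a (∣-trans e∣d d∣m , e∣a)

coprime-1 : ∀ {m} → Coprime m 1
coprime-1 (_ , d∣1) = ∣1⇒≡1 d∣1

coprime-^ : ∀ {m b} k → Coprime m b → Coprime m (b ^ k)
coprime-^ zero    m⊥b = coprime-1
coprime-^ (suc k) m⊥b = coprime-* m⊥b (coprime-^ k m⊥b)

coprime-prime : ∀ {m p} → Prime p → ¬ (p ∣ m) → Coprime m p
coprime-prime pr p∤m (d∣m , d∣p) with prime⇒irreducible pr d∣p
... | inj₁ d≡1 = d≡1
... | inj₂ refl = ⊥-elim (p∤m d∣m)

prime∤1 : ∀ {p} → Prime p → ¬ (p ∣ 1)
prime∤1 pr p∣1 = ¬prime[1] (subst Prime (∣1⇒≡1 p∣1) pr)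

prodFin-cong : ∀ t (f g : Fin t → ℕ) → (∀ i → f i ≡ g i) → prodFin t f ≡ prodFin t g
prodFin-cong zero    f g f≗g = refl
prodFin-cong (suc t) f g f≗g =
  cong₂ _*_ (f≗g fzero) (prodFin-cong t (λ i → f (fsuc i)) (λ i → g (fsuc i)) (λ i → f≗g (fsuc i)))

prodFin-* : ∀ t (f g : Fin t → ℕ) → prodFin t (λ i → f i * g i) ≡ prodFin t f * prodFin t g
prodFin-* zero    f g = refl
prodFin-* (suc t) f g = begin
  f fzero * g fzero * prodFin t (λ i → f (fsuc i) * g (fsuc i))
    ≡⟨ cong (f fzero * g fzero *_) (prodFin-* t (λ i → f (fsuc i)) (λ i → g (fsuc i))) ⟩
  f fzero * g fzero * (F * G)
    ≡⟨ solve 4 (λ a b c d → (a :* b) :* (c :* d) := (a :* c) :* (b :* d)) refl (f fzero) (g fzero) F G ⟩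
  f fzero * F * (g fzero * G) ∎
  where
  open ≡-Reasoning
  open +-*-Solver
  F = prodFin t (λ i → f (fsuc i))
  G = prodFin t (λ i → g (fsuc i))

prodFin-last : ∀ s (f : Fin (suc s) → ℕ) → prodFin (suc s) f ≡ prodFin s (λ i → f (inject₁ i)) * f (fromℕ s)
prodFin-last zero    f = *-comm (f fzero) 1
prodFin-last (suc s) f =
  trans (cong (f fzero *_) (prodFin-last s (λ i → f (fsuc i)))) (sym (*-assoc (f fzero) _ _))

factor∣prodFin : ∀ t (f : Fin t → ℕ) j → f j ∣ prodFin t f
factor∣prodFin (suc t) f fzero    = m∣m*n _
factor∣prodFin (suc t) f (fsuc j) = ∣-trans (factor∣prodFin t (λ i → f (fsuc i)) j) (n∣m*n (f fzero))

last-or-∣init : ∀ s (f : Fin (suc s) → ℕ) j → j ≡ fromℕ s ⊎ f j ∣ prodFin s (λ i → f (inject₁ i))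
last-or-∣init zero    f fzero    = inj₁ refl
last-or-∣init (suc s) f fzero    = inj₂ (m∣m*n _)
last-or-∣init (suc s) f (fsuc j) with last-or-∣init s (λ i → f (fsuc i)) j
... | inj₁ j≡last = inj₁ (cong fsuc j≡last)
... | inj₂ fj∣init = inj₂ (∣-trans fj∣init (n∣m*n (f fzero)))

prodFin-positive : ∀ t (f : Fin t → ℕ) → (∀ i → 1 ≤ f i) → 1 ≤ prodFin t f
prodFin-positive zero    f pos = s≤s z≤n
prodFin-positive (suc t) f pos = *-mono-≤ (pos fzero) (prodFin-positive t (λ i → f (fsuc i)) (λ i → pos (fsuc i)))

coprime-prodFin : ∀ {m} t (f : Fin t → ℕ) → (∀ i → Coprime m (f i)) → Coprime m (prodFin t f)
coprime-prodFin zero    f cop = coprime-1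
coprime-prodFin (suc t) f cop = coprime-* (cop fzero) (coprime-prodFin t (λ i → f (fsuc i)) (λ i → cop (fsuc i)))

subsetOf : {P : Fin n → Set} → Decidable P → Subset n
subsetOf P? = tabulate (λ i → does (P? i))

∈subsetOf⁻ : ∀ {P : Fin n → Set} (P? : Decidable P) {i} → i ∈ subsetOf P? → P i
∈subsetOf⁻ P? {i} i∈ with P? i | trans (sym (lookup∘tabulate (λ j → does (P? j)) i)) ([]=⇒lookup i∈)
... | yes Pi | _ = Pi
... | no _   | ()

∈subsetOf⁺ : ∀ {P : Fin n → Set} (P? : Decidable P) {i} → P i → i ∈ subsetOf P?
∈subsetOf⁺ P? {i} Pi = lookup⇒[]= i _ (trans (lookup∘tabulate (λ j → does (P? j)) i) (dec-true (P? i) Pi))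

∣p∪q∣≤∣p∣+∣q∣ : ∀ (A B : Subset n) → ∣ A ∪ B ∣ ≤ ∣ A ∣ + ∣ B ∣
∣p∪q∣≤∣p∣+∣q∣ []            []            = z≤n
∣p∪q∣≤∣p∣+∣q∣ (outside ∷ A) (outside ∷ B) = ∣p∪q∣≤∣p∣+∣q∣ A B
∣p∪q∣≤∣p∣+∣q∣ (outside ∷ A) (inside  ∷ B) = subst (suc ∣ A ∪ B ∣ ≤_) (sym (+-suc ∣ A ∣ ∣ B ∣)) (s≤s (∣p∪q∣≤∣p∣+∣q∣ A B))
∣p∪q∣≤∣p∣+∣q∣ (inside  ∷ A) (outside ∷ B) = s≤s (∣p∪q∣≤∣p∣+∣q∣ A B)
∣p∪q∣≤∣p∣+∣q∣ (inside  ∷ A) (inside  ∷ B) = s≤s (≤-trans (∣p∪q∣≤∣p∣+∣q∣ A B) (+-monoʳ-≤ ∣ A ∣ (n≤1+n ∣ B ∣)))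

covered⇒∣∣≤ : ∀ (A B C : Subset n) → (∀ {i} → i ∈ A → i ∈ B ⊎ i ∈ C) → ∣ A ∣ ≤ ∣ B ∣ + ∣ C ∣
covered⇒∣∣≤ A B C cover = ≤-trans (p⊆q⇒∣p∣≤∣q∣ (λ i∈A → x∈p∪q⁺ (cover i∈A))) (∣p∪q∣≤∣p∣+∣q∣ B C)

AtMostTwo : (Fin n → Set) → Set
AtMostTwo P = ∀ {i j k} → P i → P j → P k → i ≢ j → i ≢ k → j ≢ k → ⊥

empty⇒∣∣≤0 : ∀ (A : Subset n) → Empty A → ∣ A ∣ ≤ 0
empty⇒∣∣≤0 {n} A empty = ≤-reflexive (trans (cong ∣_∣ (Empty-unique empty)) (∣⊥∣≡0 n))

singleton⇒∣∣≤1 : ∀ (A : Subset n) → (∀ {i j} → i ∈ A → j ∈ A → i ≡ j) → ∣ A ∣ ≤ 1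
singleton⇒∣∣≤1 []            single = z≤n
singleton⇒∣∣≤1 (outside ∷ A) single = singleton⇒∣∣≤1 A (λ i∈ j∈ → suc-injective (single (there i∈) (there j∈)))
singleton⇒∣∣≤1 (inside  ∷ A) single = s≤s (empty⇒∣∣≤0 A (λ (i , i∈) → 0≢suc (single here (there i∈))))
  where
  0≢suc : ∀ {m} {i : Fin m} → fzero ≢ fsuc i
  0≢suc ()

atMostTwo⇒∣∣≤2 : ∀ (A : Subset n) → AtMostTwo (_∈ A) → ∣ A ∣ ≤ 2
atMostTwo⇒∣∣≤2 []            two = z≤n
atMostTwo⇒∣∣≤2 (outside ∷ A) two = atMostTwo⇒∣∣≤2 A (λ i∈ j∈ k∈ i≢j i≢k j≢k →
  two (there i∈) (there j∈) (there k∈) (i≢j ∘suc) (i≢k ∘suc) (j≢k ∘suc))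
  where
  _∘suc : ∀ {m} {i j : Fin m} → i ≢ j → fsuc i ≢ fsuc j
  (i≢j ∘suc) eq = i≢j (suc-injective eq)
atMostTwo⇒∣∣≤2 (inside  ∷ A) two = s≤s (singleton⇒∣∣≤1 A single)
  where
  single : ∀ {i j} → i ∈ A → j ∈ A → i ≡ j
  single {i} {j} i∈ j∈ with i ≟ j
  ... | yes i≡j = i≡j
  ... | no  i≢j = ⊥-elim (two here (there i∈) (there j∈) (λ ()) (λ ()) (λ eq → i≢j (suc-injective eq)))

fibres≤2⇒∣∣≤2m : ∀ m (A : Subset n) (f : Fin n → ℕ) → (∀ {i} → i ∈ A → f i < m) →
  (∀ c → AtMostTwo (λ i → i ∈ A × f i ≡ c)) → ∣ A ∣ ≤ 2 * m
fibres≤2⇒∣∣≤2m zero    A f bounded fibres = empty⇒∣∣≤0 A (λ (i , i∈) → n≮0 (bounded i∈))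
fibres≤2⇒∣∣≤2m (suc m) A f bounded fibres = begin
  ∣ A ∣             ≤⟨ covered⇒∣∣≤ A Below Top cover ⟩
  ∣ Below ∣ + ∣ Top ∣ ≤⟨ +-mono-≤ below-bound top-bound ⟩
  2 * m + 2         ≡⟨ trans (+-comm (2 * m) 2) (sym (*-suc 2 m)) ⟩
  2 * suc m         ∎
  where
  open ≤-Reasoning
  below? : Decidable (λ i → i ∈ A × f i < m)
  below? i = (i ∈? A) ×-dec (f i <? m)
  top? : Decidable (λ i → i ∈ A × f i ≡ m)
  top? i = (i ∈? A) ×-dec (f i ≟ℕ m)
  Below = subsetOf below?
  Top   = subsetOf top?
  below⁻ = ∈subsetOf⁻ below?
  top⁻   = ∈subsetOf⁻ top?
  cover : ∀ {i} → i ∈ A → i ∈ Below ⊎ i ∈ Top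
  cover i∈ with m<1+n⇒m<n∨m≡n (bounded i∈)
  ... | inj₁ fi<m = inj₁ (∈subsetOf⁺ below? (i∈ , fi<m))
  ... | inj₂ fi≡m = inj₂ (∈subsetOf⁺ top? (i∈ , fi≡m))
  below-bound : ∣ Below ∣ ≤ 2 * m
  below-bound = fibres≤2⇒∣∣≤2m m Below f (λ i∈ → proj₂ (below⁻ i∈))
    (λ c (i∈ , fi) (j∈ , fj) (k∈ , fk) →
      fibres c (proj₁ (below⁻ i∈) , fi) (proj₁ (below⁻ j∈) , fj) (proj₁ (below⁻ k∈) , fk))
  top-bound : ∣ Top ∣ ≤ 2
  top-bound = atMostTwo⇒∣∣≤2 Top (λ i∈ j∈ k∈ → fibres m (top⁻ i∈) (top⁻ j∈) (top⁻ k∈))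

countBelow : (ℕ → Bool) → ℕ → ℕ
countBelow h zero    = 0
countBelow h (suc m) = if h 0 then suc (countBelow (λ x → h (suc x)) m) else countBelow (λ x → h (suc x)) m

∣tabulate∣≡countBelow : ∀ n (h : ℕ → Bool) → ∣ tabulate {n = n} (λ i → h (toℕ i)) ∣ ≡ countBelow h n
∣tabulate∣≡countBelow zero    h = refl
∣tabulate∣≡countBelow (suc n) h with h 0
... | true  = cong suc (∣tabulate∣≡countBelow n (λ x → h (suc x)))
... | false = ∣tabulate∣≡countBelow n (λ x → h (suc x))

countBelow-+ : ∀ (h : ℕ → Bool) a b → countBelow h (a + b) ≡ countBelow h a + countBelow (λ x → h (a + x)) b
countBelow-+ h zero    b = refl
countBelow-+ h (suc a) b with h 0
... | true  = cong suc (countBelow-+ (λ x → h (suc x)) a b)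
... | false = countBelow-+ (λ x → h (suc x)) a b

countBelow-cong : ∀ (g h : ℕ → Bool) m → (∀ x → g x ≡ h x) → countBelow g m ≡ countBelow h m
countBelow-cong g h zero    g≗h = refl
countBelow-cong g h (suc m) g≗h rewrite g≗h 0 = cong (λ c → if h 0 then suc c else c)
  (countBelow-cong (λ x → g (suc x)) (λ x → h (suc x)) m (λ x → g≗h (suc x)))

countBelow-head : ∀ (h : ℕ → Bool) m → h 0 ≡ true → 1 ≤ countBelow h (suc m)
countBelow-head h m h0 rewrite h0 = s≤s z≤n

countBelow-multiples : ∀ d k → .{{_ : NonZero d}} → k ≤ countBelow (λ x → does (d ∣? x)) (k * d)
countBelow-multiples d       zero    = z≤n
countBelow-multiples (suc e) (suc k) = begin
  suc k                                     ≤⟨ s≤s (countBelow-multiples (suc e) k) ⟩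
  suc (countBelow isMultiple (k * d))       ≡⟨ cong suc (countBelow-cong isMultiple _ (k * d) shift-invariant) ⟩
  suc (countBelow (λ x → isMultiple (d + x)) (k * d))
                                            ≤⟨ +-monoˡ-≤ _ (countBelow-head isMultiple e (dec-true (d ∣? 0) (d ∣0))) ⟩
  countBelow isMultiple d + countBelow (λ x → isMultiple (d + x)) (k * d)
                                            ≤⟨ ≤-reflexive (sym (countBelow-+ isMultiple d (k * d))) ⟩
  countBelow isMultiple (d + k * d)         ∎
  where
  open ≤-Reasoning
  d = suc e
  isMultiple = λ x → does (d ∣? x)
  shift-invariant : ∀ x → isMultiple x ≡ isMultiple (d + x)
  shift-invariant x = does-⇔ (mk⇔ (∣m∣n⇒∣m+n ∣-refl) (λ d∣d+x → ∣m+n∣m⇒∣n d∣d+x ∣-refl))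
    (d ∣? x) (d ∣? (d + x))

adj-sym : ∀ {x y} → Adj n x y → Adj n y x
adj-sym {n} {x} {y} (x≢y , gcd≡1) = (λ y≡x → x≢y (sym y≡x)) , subst (λ z → gcd z n ≡ 1) (∣-∣-comm (toℕ x) (toℕ y)) gcd≡1

-- Lower bound on α: for a divisor d ≥ 2 of n the multiples of d in
-- {0,…,n-1} form an independent set of size n/d, so n ≤ d·α(X_n).
n≤d*α : ∀ n d al → 2 ≤ d → d ∣ n → IsIndependenceNumber n al → n ≤ d * al
n≤d*α n d@(suc e) al 2≤d (divides k refl) (_ , maximal) = begin
  k * d                   ≤⟨ *-monoˡ-≤ d k≤∣M∣ ⟩
  ∣ Multiples ∣ * d       ≤⟨ *-monoˡ-≤ d (maximal Multiples independent) ⟩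
  al * d                  ≡⟨ *-comm al d ⟩
  d * al                  ∎
  where
  open ≤-Reasoning
  multiple? : Decidable (λ (i : Fin (k * d)) → d ∣ toℕ i)
  multiple? i = d ∣? toℕ i
  Multiples = subsetOf multiple?
  k≤∣M∣ : k ≤ ∣ Multiples ∣
  k≤∣M∣ = subst (k ≤_) (sym (∣tabulate∣≡countBelow (k * d) (λ x → does (d ∣? x)))) (countBelow-multiples d k)
  d∤1 : ¬ (d ∣ 1)
  d∤1 d∣1 = <⇒≢ 2≤d (sym (∣1⇒≡1 d∣1))
  independent : Independent (k * d) Multiples
  independent x y x∈ y∈ (_ , gcd≡1) =
    d∤1 (subst (d ∣_) gcd≡1 (gcd-greatest (divides-difference x≡y) (n∣m*n k)))
    where
    x≡y = ≡mod-trans (≡mod-0 (∈subsetOf⁻ multiple? x∈)) (≡mod-sym (≡mod-0 (∈subsetOf⁻ multiple? y∈)))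

-- The vertices that are their own private neighbour form an
-- independent set; the remaining ("outward") vertices are adjacent to
-- theirs.
module IrredundantSplit (n : ℕ) (S : Subset n) (irredundant : Irredundant n S) where

  pn : Fin n → Fin n
  pn v with v ∈? S
  ... | yes v∈ = proj₁ (irredundant v v∈)
  ... | no _   = v

  pn-private : ∀ {v} → v ∈ S → PrivateNbr n S v (pn v)
  pn-private {v} v∈ with v ∈? S
  ... | yes v∈′ = proj₂ (irredundant v v∈′)
  ... | no  v∉  = ⊥-elim (v∉ v∈)

  selfish? : Decidable (λ v → v ∈ S × pn v ≡ v)
  selfish? v = (v ∈? S) ×-dec (pn v ≟ v)
  outward? : Decidable (λ v → v ∈ S × pn v ≢ v)
  outward? v = (v ∈? S) ×-dec ¬? (pn v ≟ v)
  Selfish = subsetOf selfish?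
  Outward = subsetOf outward?

  outward⁻ : ∀ {v} → v ∈ Outward → v ∈ S × pn v ≢ v
  outward⁻ = ∈subsetOf⁻ outward?

  outward-adjacent : ∀ {v} → v ∈ Outward → Adj n v (pn v)
  outward-adjacent {v} v∈ with proj₁ (pn-private (proj₁ (outward⁻ v∈)))
  ... | inj₁ pn≡v = ⊥-elim (proj₂ (outward⁻ v∈) pn≡v)
  ... | inj₂ adj  = adj

  selfish-independent : Independent n Selfish
  selfish-independent x y x∈ y∈ x~y =
    proj₂ (pn-private x∈S) y y∈S (λ y≡x → proj₁ x~y (sym y≡x)) (inj₂ (subst (Adj n y) (sym pnx≡x) (adj-sym x~y)))
    where
    x∈S   = proj₁ (∈subsetOf⁻ selfish? x∈)
    pnx≡x = proj₂ (∈subsetOf⁻ selfish? x∈)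
    y∈S   = proj₁ (∈subsetOf⁻ selfish? y∈)

  ∣S∣≤α+∣Outward∣ : ∀ al → IsIndependenceNumber n al → ∣ S ∣ ≤ al + ∣ Outward ∣
  ∣S∣≤α+∣Outward∣ al (_ , maximal) =
    ≤-trans (covered⇒∣∣≤ S Selfish Outward cover) (+-monoˡ-≤ ∣ Outward ∣ (maximal Selfish selfish-independent))
    where
    cover : ∀ {v} → v ∈ S → v ∈ Selfish ⊎ v ∈ Outward
    cover {v} v∈ with pn v ≟ v
    ... | yes pnv≡v = inj₁ (∈subsetOf⁺ selfish? (v∈ , pnv≡v))
    ... | no  pnv≢v = inj₂ (∈subsetOf⁺ outward? (v∈ , pnv≢v))

-- X_n for n with prime factorisation n = p_0^{a_0} ⋯ p_s^{a_s}; here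
-- q = p_s is the last prime, R = p_0 ⋯ p_{s-1} and P = ∏ p_i^{a_i-1}.
module Factorised (n s : ℕ) (p a : Fin (suc s) → ℕ) (fact : IsFactorisation n s p a) where

  q = p (fromℕ s)
  R = prodFin s (λ i → p (inject₁ i))
  P = prodFin (suc s) (λ i → p i ^ (a i ∸ 1))

  p-prime : ∀ i → Prime (p i)
  p-prime = proj₁ fact

  n≡∏p^a : n ≡ prodFin (suc s) (λ i → p i ^ a i)
  n≡∏p^a = proj₂ (proj₂ (proj₂ fact))

  p≥2 : ∀ i → 2 ≤ p i
  p≥2 i = nonTrivial⇒n>1 (p i) {{prime⇒nonTrivial (p-prime i)}}

  -- Uses a_i ≥ 1.
  ^-pred : ∀ i → p i ^ a i ≡ p i * p i ^ (a i ∸ 1)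
  ^-pred i with a i | proj₁ (proj₂ (proj₂ fact)) i
  ... | suc b | _ = refl

  p∣n : ∀ i → p i ∣ n
  p∣n i = subst (p i ∣_) (sym n≡∏p^a)
    (∣-trans (subst (p i ∣_) (sym (^-pred i)) (m∣m*n _)) (factor∣prodFin (suc s) (λ j → p j ^ a j) i))

  instance
    R-nonZero : NonZero R
    R-nonZero = >-nonZero (prodFin-positive s (λ i → p (inject₁ i)) (λ i → ≤-trans (s≤s z≤n) (p≥2 (inject₁ i))))

  n≡R*[q*P] : n ≡ R * (q * P)
  n≡R*[q*P] = begin
    n                                                ≡⟨ n≡∏p^a ⟩
    prodFin (suc s) (λ i → p i ^ a i)                ≡⟨ prodFin-cong (suc s) _ _ ^-pred ⟩
    prodFin (suc s) (λ i → p i * p i ^ (a i ∸ 1))    ≡⟨ prodFin-* (suc s) p (λ i → p i ^ (a i ∸ 1)) ⟩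
    prodFin (suc s) p * P                            ≡⟨ cong (_* P) (prodFin-last s p) ⟩
    R * q * P                                        ≡⟨ *-assoc R q P ⟩
    R * (q * P)                                      ∎
    where open ≡-Reasoning

  adjacent⇒≢mod : ∀ {x y} i → Adj n x y → ¬ (toℕ x ≡ toℕ y [mod p i ])
  adjacent⇒≢mod i (_ , gcd≡1) (by-divisibility pi∣diff) =
    prime∤1 (p-prime i) (subst (p i ∣_) gcd≡1 (gcd-greatest pi∣diff (p∣n i)))

  ≢mod⇒adjacent : ∀ {x y} → x ≢ y → (∀ i → ¬ (toℕ x ≡ toℕ y [mod p i ])) → Adj n x y
  ≢mod⇒adjacent {x} {y} x≢y incongruent = x≢y , coprime⇒gcd≡1 (subst (Coprime ∣ toℕ x - toℕ y ∣) (sym n≡∏p^a)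
    (coprime-prodFin (suc s) (λ i → p i ^ a i) (λ i → coprime-^ (a i) (coprime-prime (p-prime i) (λ pi∣ → incongruent i (by-divisibility pi∣))))))

  ∉N[w]⇒≡mod : ∀ u w → ¬ InClosedNbhd n u w → Σ (Fin (suc s)) λ i → toℕ u ≡ toℕ w [mod p i ]
  ∉N[w]⇒≡mod u w u∉N[w]
    with ¬∀⟶∃¬ (suc s) (λ i → ¬ (p i ∣ ∣ toℕ u - toℕ w ∣)) (λ i → ¬? (p i ∣? ∣ toℕ u - toℕ w ∣))
           (λ all∤ → u∉N[w] (inj₂ (≢mod⇒adjacent (λ u≡w → u∉N[w] (inj₁ (sym u≡w))) (λ i c → all∤ i (divides-difference c)))))
  ... | i , ¬¬pi∣ with p i ∣? ∣ toℕ u - toℕ w ∣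
  ...   | yes pi∣ = i , by-divisibility pi∣
  ...   | no  pi∤ = ⊥-elim (¬¬pi∣ pi∤)

  ≡mod-all⇒N[w] : ∀ {y z w} → (∀ i → toℕ y ≡ toℕ z [mod p i ]) → Adj n y w → InClosedNbhd n z w
  ≡mod-all⇒N[w] {y} {z} {w} y≡z y~w with w ≟ z
  ... | yes w≡z = inj₁ w≡z
  ... | no  w≢z = inj₂ (≢mod⇒adjacent (λ z≡w → w≢z (sym z≡w))
                     (λ i z≡w → adjacent⇒≢mod i (adj-sym y~w) (≡mod-sym (≡mod-trans (y≡z i) z≡w))))

  ≡mod-R,q⇒≡mod-all : ∀ {y z} → y ≡ z [mod R ] → y ≡ z [mod q ] → ∀ i → y ≡ z [mod p i ]
  ≡mod-R,q⇒≡mod-all y≡z[R] y≡z[q] i with last-or-∣init s p i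
  ... | inj₁ refl   = y≡z[q]
  ... | inj₂ pi∣R   = ≡mod-divisor pi∣R y≡z[R]

  module IRBound (S : Subset n) (irredundant : Irredundant n S) where
    open IrredundantSplit n S irredundant

    -- If u ∈ S ∖ {x} is congruent to the outward vertex x modulo R, then u is
    -- congruent to pn x modulo q: some p_i divides u - pn x (privacy), and
    -- it cannot divide R, since then it would divide x - pn x.
    ≡mod-R⇒≡mod-q : ∀ {x u} → x ∈ Outward → u ∈ S → u ≢ x →
      toℕ x ≡ toℕ u [mod R ] → toℕ u ≡ toℕ (pn x) [mod q ]
    ≡mod-R⇒≡mod-q {x} {u} x∈ u∈S u≢x x≡u
      with ∉N[w]⇒≡mod u (pn x) (proj₂ (pn-private (proj₁ (outward⁻ x∈))) u u∈S u≢x)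
    ... | i , u≡pnx with last-or-∣init s p i
    ...   | inj₁ refl = u≡pnx
    ...   | inj₂ pi∣R = ⊥-elim (adjacent⇒≢mod i (outward-adjacent x∈) (≡mod-trans (≡mod-divisor pi∣R x≡u) u≡pnx))

    -- Fibre lemma: no three distinct outward vertices are congruent mod R.
    -- Given such x, y, z, both y and z are congruent to pn x modulo q, hence
    -- y ≡ z modulo every prime, so z lies in N[pn y], contradicting privacy.
    outward-fibres : ∀ c → AtMostTwo (λ v → v ∈ Outward × toℕ v % R ≡ c)
    outward-fibres c {x} {y} {z} (x∈ , x%) (y∈ , y%) (z∈ , z%) x≢y x≢z y≢z =
      proj₂ (pn-private y∈S) z z∈S (λ z≡y → y≢z (sym z≡y)) (≡mod-all⇒N[w] y≡z (outward-adjacent y∈))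
      where
      y∈S = proj₁ (outward⁻ y∈)
      z∈S = proj₁ (outward⁻ z∈)
      x≡y[R] = %≡⇒≡mod R (toℕ x) (toℕ y) (trans x% (sym y%))
      x≡z[R] = %≡⇒≡mod R (toℕ x) (toℕ z) (trans x% (sym z%))
      y≡z : ∀ i → toℕ y ≡ toℕ z [mod p i ]
      y≡z = ≡mod-R,q⇒≡mod-all (≡mod-trans (≡mod-sym x≡y[R]) x≡z[R])
        (≡mod-trans (≡mod-R⇒≡mod-q x∈ y∈S (λ y≡x → x≢y (sym y≡x)) x≡y[R])
                    (≡mod-sym (≡mod-R⇒≡mod-q x∈ z∈S (λ z≡x → x≢z (sym z≡x)) x≡z[R])))

    ∣S∣≤α+2R : ∀ al → IsIndependenceNumber n al → ∣ S ∣ ≤ al + 2 * R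
    ∣S∣≤α+2R al isα = ≤-trans (∣S∣≤α+∣Outward∣ al isα) (+-monoʳ-≤ al
      (fibres≤2⇒∣∣≤2m R Outward (λ v → toℕ v % R) (λ {v} _ → m%n<n (toℕ v) R) outward-fibres))

combine-bounds : ∀ {ir al R X n d} → ir ≤ al + 2 * R → n ≡ R * X → n ≤ d * al → ir * X ≤ (X + 2 * d) * al
combine-bounds {ir} {al} {R} {X} {n} {d} ir≤ n≡ n≤ = begin
  ir * X                   ≤⟨ *-monoˡ-≤ X ir≤ ⟩
  (al + 2 * R) * X         ≡⟨ solve 3 (λ al R X → (al :+ con 2 :* R) :* X := al :* X :+ con 2 :* (R :* X)) refl al R X ⟩
  al * X + 2 * (R * X)     ≡⟨ cong (λ m → al * X + 2 * m) (sym n≡) ⟩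
  al * X + 2 * n           ≤⟨ +-monoʳ-≤ (al * X) (*-monoʳ-≤ 2 n≤) ⟩
  al * X + 2 * (d * al)    ≡⟨ solve 3 (λ al X d → al :* X :+ con 2 :* (d :* al) := (X :+ con 2 :* d) :* al) refl al X d ⟩
  (X + 2 * d) * al         ∎
  where
  open ≤-Reasoning
  open +-*-Solver

corollary5p5 : (n s : ℕ) (p a : Fin (suc s) → ℕ) → IsFactorisation n s p a →
    (ir al : ℕ) → IsIRNumber n ir → IsIndependenceNumber n al →
    let P = prodFin (suc s) (λ i → p i ^ (a i ∸ 1)) in
    ir * (p (fromℕ s) * P) ≤ (p (fromℕ s) * P + 2 * p fzero) * al
corollary5p5 n s p a fact ir al ((S , irredundant , ∣S∣≡ir) , _) isα =
  combine-bounds {R = R} {d = p fzero} ir≤α+2R n≡R*[q*P] (n≤d*α n (p fzero) al (p≥2 fzero) (p∣n fzero) isα)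
  where
  open Factorised n s p a fact
  ir≤α+2R : ir ≤ al + 2 * R
  ir≤α+2R = subst (_≤ al + 2 * R) ∣S∣≡ir (IRBound.∣S∣≤α+2R S irredundant al isα)
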